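{- Let $\mathbf{A}$ be a bounded residuated lattice. If every $x\in A$ can be written as $x=b\ast d$ with $b$ a Boolean element of $\mathbf{A}$ and $d$ a dense element of $\mathbf{A}$, then $\mathbf{A}$ is a Stonean residuated lattice.
   Context: A residuated lattice is an algebra $(A,\ast,\to,\vee,\wedge,\top)$ with $(A,\ast,\top)$ a commutative monoid, $(A,\vee,\wedge)$ a lattice with top $\top$, and $x\ast y\le z$ iff $x\le y\to z$. A bounded residuated lattice also has a constant $\bot$ which is the least element; $\neg x:=x\to\bot$. An element $x$ is dense if $\neg x=\bot$, and Boolean if $x\vee\neg x=\top$ and $x\wedge\neg x=\bot$. A Stonean residuated lattice is a bounded residuated lattice satisfying $\neg x\vee\neg\neg x=\top$. -}

module Defs where

open import Level using (Level; suc; _⊔_)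
open import Relation.Binary.PropositionalEquality using (_≡_)
open import Data.Product using (_×_; Σ-syntax)
open import Function.Bundles using (_⇔_)

record BoundedResiduatedLattice (a : Level) : Set (suc a) where
  infixr 5 _⇒_
  infixl 7 _*_
  infixl 6 _∨_ _∧_
  infix 4 _≤_
  field
    Carrier : Set a
    _*_ _⇒_ _∨_ _∧_ : Carrier → Carrier → Carrier
    ⊤ ⊥ : Carrier
    *-assoc : ∀ x y z → (x * y) * z ≡ x * (y * z)
    *-comm : ∀ x y → x * y ≡ y * x
    *-identityʳ : ∀ x → x * ⊤ ≡ x
    ∨-assoc : ∀ x y z → (x ∨ y) ∨ z ≡ x ∨ (y ∨ z)
    ∨-comm : ∀ x y → x ∨ y ≡ y ∨ x
    ∧-assoc : ∀ x y z → (x ∧ y) ∧ z ≡ x ∧ (y ∧ z)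
    ∧-comm : ∀ x y → x ∧ y ≡ y ∧ x
    ∨-absorbs-∧ : ∀ x y → x ∨ (x ∧ y) ≡ x
    ∧-absorbs-∨ : ∀ x y → x ∧ (x ∨ y) ≡ x

  _≤_ : Carrier → Carrier → Set a
  x ≤ y = x ∧ y ≡ x

  field
    ≤-⊤ : ∀ x → x ≤ ⊤
    ⊥-≤ : ∀ x → ⊥ ≤ x
    residuated : ∀ x y z → (x * y ≤ z) ⇔ (x ≤ y ⇒ z)

  ¬_ : Carrier → Carrier
  ¬ x = x ⇒ ⊥

  IsDense : Carrier → Set a
  IsDense x = ¬ x ≡ ⊥

  IsBoolean : Carrier → Set a
  IsBoolean x = (x ∨ ¬ x ≡ ⊤) × (x ∧ ¬ x ≡ ⊥)

  IsStonean : Set a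
  IsStonean = ∀ x → ¬ x ∨ ¬ (¬ x) ≡ ⊤

  BooleanDenseDecomposable : Set a
  BooleanDenseDecomposable =
    ∀ x → Σ[ b ∈ Carrier ] Σ[ d ∈ Carrier ] (IsBoolean b × IsDense d × x ≡ b * d)

-- For a dense d, ¬ (b * d) = b ⇒ ¬ d = b ⇒ ⊥ = ¬ b, so under the decomposition
-- x = b * d the Stone identity for x reduces to the one for the Boolean b.
-- There it holds because b ≤ ¬¬b absorbs b into ¬¬b, and ¬b ∨ b = ⊤.
module Submission where

open import Defs
open import Level using (Level)
open import Relation.Binary.PropositionalEquality
open import Data.Product using (_,_)
open import Function.Bundles using (Equivalence)

module BoundedResiduatedLatticeProperties
  {a : Level} (A : BoundedResiduatedLattice a) where

  open BoundedResiduatedLattice A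
  open Equivalence
  open ≡-Reasoning

  ∧-idem : ∀ x → x ∧ x ≡ x
  ∧-idem x = trans (cong (x ∧_) (sym (∨-absorbs-∧ x x))) (∧-absorbs-∨ x (x ∧ x))

  ≤-refl : ∀ x → x ≤ x
  ≤-refl = ∧-idem

  ≤-antisym : ∀ {x y} → x ≤ y → y ≤ x → x ≡ y
  ≤-antisym {x} {y} x≤y y≤x = trans (sym x≤y) (trans (∧-comm x y) y≤x)

  ≤⇒∨≡ʳ : ∀ {x y} → x ≤ y → x ∨ y ≡ y
  ≤⇒∨≡ʳ {x} {y} x≤y = begin
    x ∨ y        ≡⟨ cong (_∨ y) (trans (sym x≤y) (∧-comm x y)) ⟩
    (y ∧ x) ∨ y  ≡⟨ ∨-comm (y ∧ x) y ⟩
    y ∨ (y ∧ x)  ≡⟨ ∨-absorbs-∧ y x ⟩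
    y            ∎

  ⊤-∨-zeroˡ : ∀ x → ⊤ ∨ x ≡ ⊤
  ⊤-∨-zeroˡ x = trans (∨-comm ⊤ x) (≤⇒∨≡ʳ (≤-⊤ x))

  ≤-indirect : ∀ {x y} → (∀ w → w ≤ x → w ≤ y) → (∀ w → w ≤ y → w ≤ x) → x ≡ y
  ≤-indirect {x} {y} x⊆y y⊆x = ≤-antisym (x⊆y x (≤-refl x)) (y⊆x y (≤-refl y))

  ⇒-curry : ∀ x y z → (x * y) ⇒ z ≡ x ⇒ (y ⇒ z)
  ⇒-curry x y z = ≤-indirect
    (λ w w≤ → to (residuated w x (y ⇒ z)) (to (residuated (w * x) y z)
                (subst (_≤ z) (sym (*-assoc w x y)) (from (residuated w (x * y) z) w≤))))
    (λ w w≤ → to (residuated w (x * y) z) (subst (_≤ z) (*-assoc w x y)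
                (from (residuated (w * x) y z) (from (residuated w x (y ⇒ z)) w≤))))

  ¬-*-dense : ∀ x {d} → IsDense d → ¬ (x * d) ≡ ¬ x
  ¬-*-dense x {d} ¬d≡⊥ = trans (⇒-curry x d ⊥) (cong (x ⇒_) ¬d≡⊥)

  x≤¬¬x : ∀ x → x ≤ ¬ (¬ x)
  x≤¬¬x x = to (residuated x (¬ x) ⊥)
    (subst (_≤ ⊥) (*-comm (¬ x) x) (from (residuated (¬ x) x ⊥) (≤-refl (¬ x))))

  boolean⇒stone : ∀ {b} → IsBoolean b → ¬ b ∨ ¬ (¬ b) ≡ ⊤
  boolean⇒stone {b} (b∨¬b≡⊤ , _) = begin
    ¬ b ∨ ¬ (¬ b)        ≡⟨ cong (¬ b ∨_) (sym (≤⇒∨≡ʳ (x≤¬¬x b))) ⟩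
    ¬ b ∨ (b ∨ ¬ (¬ b))  ≡⟨ sym (∨-assoc (¬ b) b (¬ (¬ b))) ⟩
    (¬ b ∨ b) ∨ ¬ (¬ b)  ≡⟨ cong (_∨ ¬ (¬ b)) (trans (∨-comm (¬ b) b) b∨¬b≡⊤) ⟩
    ⊤ ∨ ¬ (¬ b)          ≡⟨ ⊤-∨-zeroˡ (¬ (¬ b)) ⟩
    ⊤                    ∎

  decomposable⇒stonean : BooleanDenseDecomposable → IsStonean
  decomposable⇒stonean decompose x with decompose x
  ... | b , d , boolean-b , dense-d , refl
    rewrite ¬-*-dense b dense-d = boolean⇒stone boolean-b

lemma3p3 : {a : Level} (A : BoundedResiduatedLattice a) →
    BoundedResiduatedLattice.BooleanDenseDecomposable A →
    BoundedResiduatedLattice.IsStonean A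
lemma3p3 A = BoundedResiduatedLatticeProperties.decomposable⇒stonean A
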